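{- For every $n\ge1$, $\mathrm{thin}_{prec}(GR_{2,n})=\left\lceil\frac{n+1}{2}\right\rceil$.
   Context: $GR_{2,n}$ is the grid graph with vertex set $\{(i,j):1\le i\le 2,1\le j\le n\}$ where $(i,j)$ and $(k,l)$ are adjacent iff $|i-k|+|j-l|=1$. An ordering $<$ of $V(G)$ is consistent with a partition $\mathcal{V}$ if for every $p<q<r$ with $p,q$ in the same class and $pr\in E(G)$, also $qr\in E(G)$. The precedence thinness $\mathrm{thin}_{prec}(G)$ is the minimum $k$ such that there exist a partition of $V(G)$ into $k$ classes and an ordering consistent with it in which the vertices of each class are consecutive. -}

module Defs where

open import Data.Nat using (ℕ; suc; _+_; _*_; _<_; _≤_; ∣_-_∣)
open import Data.Fin using (Fin; toℕ)
open import Data.Product using (_×_; _,_; Σ; ∃)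
open import Relation.Binary.PropositionalEquality using (_≡_)
open import Function.Definitions using (Injective; Surjective)

-- Vertex set of GR_{2,n}: pairs (i , j) with i ∈ Fin 2, j ∈ Fin n
-- (0-based indices standing for 1 ≤ i ≤ 2, 1 ≤ j ≤ n).
GRV : ℕ → Set
GRV n = Fin 2 × Fin n

GRAdj : (n : ℕ) → GRV n → GRV n → Set
GRAdj n (i , j) (k , l) = ∣ toℕ i - toℕ k ∣ + ∣ toℕ j - toℕ l ∣ ≡ 1

-- A graph given by a vertex type V with exactly m vertices (via the
-- ordering) and an adjacency relation E.
-- An ordering of V is a bijection pos : V → Fin m (position in the order);
-- p < q in the ordering iff toℕ (pos p) < toℕ (pos q).
-- A partition into k classes is a surjective map cls : V → Fin k
-- (every class nonempty).
record PrecPartition (V : Set) (m : ℕ) (E : V → V → Set) (k : ℕ) : Set where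
  field
    pos       : V → Fin m
    pos-inj   : Injective _≡_ _≡_ pos
    pos-surj  : Surjective _≡_ _≡_ pos
    cls       : V → Fin k
    cls-surj  : Surjective _≡_ _≡_ cls
    consistent : ∀ p q r → toℕ (pos p) < toℕ (pos q) → toℕ (pos q) < toℕ (pos r) →
                 cls p ≡ cls q → E p r → E q r
    consecutive : ∀ p q r → toℕ (pos p) < toℕ (pos q) → toℕ (pos q) < toℕ (pos r) →
                  cls p ≡ cls r → cls q ≡ cls p

IsThinPrec : (V : Set) (m : ℕ) (E : V → V → Set) → ℕ → Set
IsThinPrec V m E t = PrecPartition V m E t × (∀ k → PrecPartition V m E k → t ≤ k)

module Submission where

open import Defs
open import Data.Nat as ℕ using (ℕ; zero; suc; _+_; _*_; _≤_; _<_; s≤s; z≤n; ∣_-_∣; parity; ⌊_/2⌋; ⌈_/2⌉)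
import Data.Nat.Properties as ℕ
open import Data.Fin as F using (Fin; toℕ)
open import Data.Fin.Patterns using (0F; 1F)
import Data.Fin.Properties as FP
open import Data.Fin.Induction using (>-wellFounded)
open import Data.List using (List; []; _∷_)
open import Data.List.Relation.Unary.All using (All; []; _∷_)
import Data.List.Relation.Unary.All as All
open import Data.List.Relation.Unary.All.Properties using (¬Any⇒All¬)
open import Data.List.Relation.Unary.Any using (Any; here; there; any?)
open import Data.List.Membership.Propositional using (find)
open import Data.List.Extrema.Nat using (argmin; argmin-all; f[argmin]≤f[⊤]; f[argmin]≤f[xs])
open import Data.Product using (Σ; ∃; _×_; _,_; proj₁; proj₂; uncurry)
open import Data.Sum as Sum using (_⊎_; inj₁; inj₂)
open import Data.Parity using (Parity; 0ℙ; 1ℙ; _⁻¹)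
import Data.Parity.Properties as ℙ
open import Data.Empty using (⊥; ⊥-elim)
open import Induction.WellFounded using (Acc; acc)
open import Relation.Nullary using (¬_; yes; no; _×-dec_)
open import Relation.Binary.PropositionalEquality
open import Relation.Binary.Definitions using (tri<; tri≈; tri>)
open import Function.Definitions using (Injective; Surjective)
open import Function.Base using (_∘_)
open import Data.Nat.Tactic.RingSolver using (solve-∀)

-- In GR_{2,n} the square on columns j, j+1 is an induced 4-cycle, and common
-- neighbours of its opposite corners lie in those columns. In a consistent partition with
-- consecutive classes no such square lies in one class, and if v is outside the square and has
-- the class κ of its first corner, then some corner of class κ comes after v. So two squares on
-- disjoint columns sharing κ would force an endless ascent alternating between them: the
-- ⌊n/2⌋ squares on columns 2i, 2i+1 have distinct classes κ, none the class of the last vertex.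
--
-- First take the ⌊n/2⌋ top vertices in odd columns, as singleton classes, and then
-- all other vertices as one class in the order (0,0), (1,0), (1,1), (0,2), (1,2), (1,3), ...
-- In this order a vertex's earlier neighbours within the last class come right before it.

record Square {V : Set} (E : V → V → Set) (S : V → Set) : Set where
  field
    a b c d : V
    ab : E a b
    bc : E b c
    cd : E c d
    da : E d a
    a≁c : ¬ E a c
    b≁d : ¬ E b d
    a≢c : a ≢ c
    b≢d : b ≢ d
    ac-common : ∀ {v} → E v a → E v c → S v
    bd-common : ∀ {v} → E v b → E v d → S v
    corners⊆S : All S (a ∷ b ∷ c ∷ d ∷ [])

  corners : List V
  corners = a ∷ b ∷ c ∷ d ∷ []

All-rotate : ∀ {A : Set} {P : A → Set} {w x y z} → All P (w ∷ x ∷ y ∷ z ∷ []) → All P (x ∷ y ∷ z ∷ w ∷ [])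
All-rotate (pw ∷ px ∷ py ∷ pz ∷ []) = px ∷ py ∷ pz ∷ pw ∷ []

rotate : ∀ {V : Set} {E : V → V → Set} {S} → (∀ {x y} → E x y → E y x) → Square E S → Square E S
rotate E-sym Q = record
  { a = b ; b = c ; c = d ; d = a
  ; ab = bc ; bc = cd ; cd = da ; da = ab
  ; a≁c = b≁d ; b≁d = λ e → a≁c (E-sym e)
  ; a≢c = b≢d ; b≢d = λ e → a≢c (sym e)
  ; ac-common = bd-common ; bd-common = λ va vc → ac-common vc va
  ; corners⊆S = All-rotate corners⊆S
  }
  where open Square Q

inhabited⇒greatest : ∀ {m} → Fin m → Σ (Fin m) λ l → ∀ (i : Fin m) → i F.≤ l
inhabited⇒greatest {suc m} _ = F.fromℕ m , FP.≤fromℕ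

module PrecPartitionProperties
  {V : Set} {E : V → V → Set}
  (E-sym : ∀ {x y} → E x y → E y x)
  (triangle-free : ∀ {x y z} → E x y → E y z → E x z → ⊥)
  {m k : ℕ} (P : PrecPartition V m E k) where

  open PrecPartition P

  ordinal : V → ℕ
  ordinal v = toℕ (pos v)

  _≺_ _≼_ : V → V → Set
  x ≺ y = pos x F.< pos y
  x ≼ y = pos x F.≤ pos y

  irreflexive : ∀ {x} → ¬ E x x
  irreflexive e = triangle-free e e e

  adjacent⇒≢ : ∀ {x y} → E x y → x ≢ y
  adjacent⇒≢ e refl = irreflexive e

  ≢⇒≺⊎≻ : ∀ {x y} → x ≢ y → x ≺ y ⊎ y ≺ x
  ≢⇒≺⊎≻ {x} {y} x≢y with FP.<-cmp (pos x) (pos y)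
  ... | tri< x≺y _ _ = inj₁ x≺y
  ... | tri≈ _ x≡y _ = ⊥-elim (x≢y (pos-inj x≡y))
  ... | tri> _ _ y≺x = inj₂ y≺x

  inherit : ∀ {p q r} → p ≺ q → q ≺ r → cls p ≡ cls q → E p r → E q r
  inherit = consistent _ _ _

  class-between : ∀ {x w z} → x ≼ w → w ≼ z → cls x ≡ cls z → cls w ≡ cls x
  class-between {x} {w} {z} x≼w w≼z x~z with ℕ.m≤n⇒m<n∨m≡n x≼w | ℕ.m≤n⇒m<n∨m≡n w≼z
  ... | inj₁ x≺w | inj₁ w≺z = consecutive x w z x≺w w≺z x~z
  ... | inj₂ x≡w | _        = cong cls (sym (pos-inj (FP.toℕ-injective x≡w)))
  ... | _        | inj₂ w≡z = trans (cong cls (pos-inj (FP.toℕ-injective w≡z))) (sym x~z)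

  no-endless-ascent : (R : V → Set) → (∀ {v} → R v → ∃ λ u → R u × v ≺ u) → ∀ {v} → ¬ R v
  no-endless-ascent R step {v} = go v (>-wellFounded (pos v))
    where
    go : ∀ v → Acc F._>_ (pos v) → ¬ R v
    go v (acc later) Rv with step Rv
    ... | u , Ru , v≺u = go u (later v≺u) Ru

  module _ {S : V → Set} (Q : Square E S) where
    open Square Q

    ¬classmates-before-a : ∀ {κ} → cls b ≡ κ → cls c ≡ κ → cls d ≡ κ → b ≺ a → c ≺ a → d ≺ a → ⊥
    ¬classmates-before-a κb κc κd b≺a c≺a d≺a
      with ≢⇒≺⊎≻ (adjacent⇒≢ bc) | ≢⇒≺⊎≻ (adjacent⇒≢ cd)
    ... | inj₁ b≺c | _ = a≁c (E-sym (inherit b≺c c≺a (trans κb (sym κc)) (E-sym ab)))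
    ... | inj₂ c≺b | inj₂ d≺c = a≁c (E-sym (inherit d≺c c≺a (trans κd (sym κc)) da))
    ... | inj₂ c≺b | inj₁ c≺d with ≢⇒≺⊎≻ b≢d
    ...   | inj₁ b≺d = b≁d (inherit c≺b b≺d (trans κc (sym κb)) cd)
    ...   | inj₂ d≺b = b≁d (E-sym (inherit c≺d d≺b (trans κc (sym κd)) (E-sym bc)))

  ↻ : ∀ {S} → Square E S → Square E S
  ↻ = rotate E-sym

  module _ {S : V → Set} (Q : Square E S) where
    open Square Q

    ¬monochromatic : ∀ {κ} → All (λ w → cls w ≡ κ) corners → ⊥
    ¬monochromatic (κa ∷ κb ∷ κc ∷ κd ∷ []) with ≢⇒≺⊎≻ a≢c | ≢⇒≺⊎≻ b≢d
    ... | inj₁ a≺c | inj₁ b≺d with ≢⇒≺⊎≻ (adjacent⇒≢ cd)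
    ...   | inj₁ c≺d = ¬classmates-before-a (↻ (↻ (↻ Q))) κa κb κc (FP.<-trans a≺c c≺d) b≺d c≺d
    ...   | inj₂ d≺c = ¬classmates-before-a (↻ (↻ Q)) κd κa κb d≺c a≺c (FP.<-trans b≺d d≺c)
    ¬monochromatic (κa ∷ κb ∷ κc ∷ κd ∷ []) | inj₁ a≺c | inj₂ d≺b with ≢⇒≺⊎≻ (adjacent⇒≢ bc)
    ...   | inj₁ b≺c = ¬classmates-before-a (↻ (↻ Q)) κd κa κb (FP.<-trans d≺b b≺c) a≺c b≺c
    ...   | inj₂ c≺b = ¬classmates-before-a (↻ Q) κc κd κa c≺b d≺b (FP.<-trans a≺c c≺b)
    ¬monochromatic (κa ∷ κb ∷ κc ∷ κd ∷ []) | inj₂ c≺a | inj₁ b≺d with ≢⇒≺⊎≻ (adjacent⇒≢ da)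
    ...   | inj₁ d≺a = ¬classmates-before-a Q κb κc κd (FP.<-trans b≺d d≺a) c≺a d≺a
    ...   | inj₂ a≺d = ¬classmates-before-a (↻ (↻ (↻ Q))) κa κb κc a≺d b≺d (FP.<-trans c≺a a≺d)
    ¬monochromatic (κa ∷ κb ∷ κc ∷ κd ∷ []) | inj₂ c≺a | inj₂ d≺b with ≢⇒≺⊎≻ (adjacent⇒≢ ab)
    ...   | inj₁ a≺b = ¬classmates-before-a (↻ Q) κc κd κa (FP.<-trans c≺a a≺b) d≺b a≺b
    ...   | inj₂ b≺a = ¬classmates-before-a Q κb κc κd b≺a c≺a (FP.<-trans d≺b b≺a)

    opaque
      firstCorner : V
      firstCorner = argmin ordinal a (b ∷ c ∷ d ∷ [])

      firstCorner-≼ : All (firstCorner ≼_) corners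
      firstCorner-≼ = f[argmin]≤f[⊤] {f = ordinal} a (b ∷ c ∷ d ∷ []) ∷ f[argmin]≤f[xs] {f = ordinal} a (b ∷ c ∷ d ∷ [])

      firstCorner∈S : S firstCorner
      firstCorner∈S = argmin-all ordinal {a} {b ∷ c ∷ d ∷ []} {P = S} (All.head corners⊆S) (All.tail corners⊆S)

      firstClass-at-corner : Any (λ w → cls w ≡ cls firstCorner) corners
      firstClass-at-corner = argmin-all ordinal {a} {b ∷ c ∷ d ∷ []} {P = λ x → Any (λ w → cls w ≡ cls x) corners}
        (here refl) (there (here refl) ∷ there (there (here refl)) ∷ there (there (there (here refl))) ∷ [])

    firstClass : Fin k
    firstClass = cls firstCorner

  Split : V → Fin k → V → Set
  Split v κ w = (cls w ≡ κ → w ≺ v) × (cls w ≢ κ → v ≺ w)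

  module _ {S : V → Set} {v : V} {κ : Fin k} (v∉S : ¬ S v) (κv : cls v ≡ κ) where

    private
      precedes : ∀ {w y} → Split v κ w → Split v κ y → cls w ≡ κ → cls y ≢ κ → w ≺ y
      precedes (w≺v , _) (_ , v≺y) κw κy = FP.<-trans (w≺v κw) (v≺y κy)

      inherit-across : ∀ {w y} → Split v κ w → Split v κ y → cls w ≡ κ → cls y ≢ κ → E w y → E v y
      inherit-across (w≺v , _) (_ , v≺y) κw κy = inherit (w≺v κw) (v≺y κy) (trans κw (sym κv))

    module _ (Q : Square E S) where
      open Square Q

      ¬corners-split-at-a : cls a ≡ κ → All (Split v κ) corners → ⊥
      ¬corners-split-at-a κa (sa ∷ sb ∷ sc ∷ sd ∷ []) with cls b FP.≟ κ | cls d FP.≟ κ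
      ... | no κb | no κd =
        v∉S (bd-common (inherit-across sa sb κa κb ab) (inherit-across sa sd κa κd (E-sym da)))
      ... | yes κb | no κd with cls c FP.≟ κ
      ...   | no κc =
        triangle-free (inherit-across sb sc κb κc bc) cd (inherit-across sa sd κa κd (E-sym da))
      ...   | yes κc = ¬classmates-before-a (↻ (↻ (↻ Q))) κa κb κc
                         (precedes sa sd κa κd) (precedes sb sd κb κd) (precedes sc sd κc κd)
      ¬corners-split-at-a κa (sa ∷ sb ∷ sc ∷ sd ∷ []) | no κb | yes κd with cls c FP.≟ κ
      ...   | no κc =
        triangle-free (inherit-across sa sb κa κb ab) bc (inherit-across sd sc κd κc (E-sym cd))
      ...   | yes κc = ¬classmates-before-a (↻ Q) κc κd κa
                         (precedes sc sb κc κb) (precedes sd sb κd κb) (precedes sa sb κa κb)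
      ¬corners-split-at-a κa (sa ∷ sb ∷ sc ∷ sd ∷ []) | yes κb | yes κd with cls c FP.≟ κ
      ...   | no κc = ¬classmates-before-a (↻ (↻ Q)) κd κa κb
                         (precedes sd sc κd κc) (precedes sa sc κa κc) (precedes sb sc κb κc)
      ...   | yes κc = ¬monochromatic Q (κa ∷ κb ∷ κc ∷ κd ∷ [])

    ¬corners-split : (Q : Square E S) →
      Any (λ w → cls w ≡ κ) (Square.corners Q) → All (Split v κ) (Square.corners Q) → ⊥
    ¬corners-split Q (here κa) = ¬corners-split-at-a Q κa
    ¬corners-split Q (there (here κb)) = ¬corners-split-at-a (↻ Q) κb ∘ All-rotate
    ¬corners-split Q (there (there (here κc))) =
      ¬corners-split-at-a (↻ (↻ Q)) κc ∘ All-rotate ∘ All-rotate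
    ¬corners-split Q (there (there (there (here κd)))) =
      ¬corners-split-at-a (↻ (↻ (↻ Q))) κd ∘ All-rotate ∘ All-rotate ∘ All-rotate

  module _ {S : V → Set} (Q : Square E S) where
    open Square Q

    firstClass-reappears : ∀ {v} → ¬ S v → cls v ≡ firstClass Q → ∃ λ u → S u × cls u ≡ firstClass Q × v ≺ u
    firstClass-reappears {v} v∉S κv with any? (λ w → cls w FP.≟ firstClass Q ×-dec pos v FP.<? pos w) corners
    ... | yes found with u , u∈ , κu , v≺u ← find found = u , All.lookup corners⊆S u∈ , κu , v≺u
    -- Otherwise the corners of v's class all precede v and, classes being consecutive, the rest follow it.
    ... | no none = ⊥-elim (¬corners-split v∉S κv Q (firstClass-at-corner Q)
                      (All.tabulate λ w∈ → split (All.lookup corners⊆S w∈) (All.lookup (firstCorner-≼ Q) w∈)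
                                                 (All.lookup (¬Any⇒All¬ corners none) w∈)))
      where
      split : ∀ {w} → S w → firstCorner Q ≼ w → ¬ (cls w ≡ firstClass Q × v ≺ w) → Split v (firstClass Q) w
      split {w} Sw x≼w ¬later with ≢⇒≺⊎≻ (λ w≡v → v∉S (subst S w≡v Sw))
      ... | inj₁ w≺v = (λ _ → w≺v) , λ κw → ⊥-elim (κw (class-between x≼w (ℕ.<⇒≤ w≺v) (sym κv)))
      ... | inj₂ v≺w = (λ κw → ⊥-elim (¬later (κw , v≺w))) , λ _ → v≺w

  disjoint⇒distinct-firstClass : ∀ {S S'} (Q : Square E S) (Q' : Square E S') →
                                 (∀ {v} → S v → ¬ S' v) → firstClass Q ≢ firstClass Q'
  disjoint⇒distinct-firstClass {S} {S'} Q Q' disjoint κ≡κ' =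
    no-endless-ascent R step (refl , inj₁ (firstCorner∈S Q))
    where
    R : V → Set
    R v = cls v ≡ firstClass Q × (S v ⊎ S' v)
    step : ∀ {v} → R v → ∃ λ u → R u × v ≺ u
    step (κv , inj₁ Sv) with u , S'u , κu , v≺u ← firstClass-reappears Q' (disjoint Sv) (trans κv κ≡κ') =
      u , (trans κu (sym κ≡κ') , inj₂ S'u) , v≺u
    step (κv , inj₂ S'v) with u , Su , κu , v≺u ← firstClass-reappears Q (λ Sv → disjoint Sv S'v) κv =
      u , (κu , inj₁ Su) , v≺u

  last-vertex-class≢firstClass : ∀ {S z} → (∀ w → w ≼ z) → (Q : Square E S) → cls z ≢ firstClass Q
  last-vertex-class≢firstClass z-last Q κz =
    ¬monochromatic Q (All.map (λ {w} x≼w → class-between x≼w (z-last w) (sym κz)) (firstCorner-≼ Q))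

  ∃-last-vertex : V → ∃ λ z → ∀ w → w ≼ z
  ∃-last-vertex v with last , ≤last ← inhabited⇒greatest (pos v) with z , pos-z ← pos-surj last =
    z , λ w → subst (pos w F.≤_) (sym (pos-z refl)) (≤last (pos w))

  more-classes-than-disjoint-squares :
    ∀ {h} {S : Fin h → V → Set} (Q : ∀ i → Square E (S i)) →
    (∀ {i j} → i ≢ j → ∀ {v} → S i v → ¬ S j v) → V → suc h ≤ k
  more-classes-than-disjoint-squares {h} Q disjoint v with z , z-last ← ∃-last-vertex v =
    FP.injective⇒≤ classes-injective
    where
    classes : Fin (suc h) → Fin k
    classes F.zero = cls z
    classes (F.suc i) = firstClass (Q i)
    classes-injective : Injective _≡_ _≡_ classes
    classes-injective {F.zero} {F.zero} _ = refl
    classes-injective {F.zero} {F.suc j} eq = ⊥-elim (last-vertex-class≢firstClass z-last (Q j) eq)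
    classes-injective {F.suc i} {F.zero} eq = ⊥-elim (last-vertex-class≢firstClass z-last (Q i) (sym eq))
    classes-injective {F.suc i} {F.suc j} eq with i FP.≟ j
    ... | yes i≡j = cong F.suc i≡j
    ... | no i≢j = ⊥-elim (disjoint⇒distinct-firstClass (Q i) (Q j) (disjoint i≢j) eq)

no-three-distinct-parities : ∀ {p q r : Parity} → p ≢ q → q ≢ r → p ≢ r → ⊥
no-three-distinct-parities {0ℙ} {0ℙ} p≢q _ _ = p≢q refl
no-three-distinct-parities {1ℙ} {1ℙ} p≢q _ _ = p≢q refl
no-three-distinct-parities {_} {0ℙ} {0ℙ} _ q≢r _ = q≢r refl
no-three-distinct-parities {_} {1ℙ} {1ℙ} _ q≢r _ = q≢r refl
no-three-distinct-parities {0ℙ} {1ℙ} {0ℙ} _ _ p≢r = p≢r refl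
no-three-distinct-parities {1ℙ} {0ℙ} {1ℙ} _ _ p≢r = p≢r refl

two-colourable⇒triangle-free : ∀ {V : Set} {E : V → V → Set} (colour : V → Parity) →
  (∀ {x y} → E x y → colour x ≢ colour y) → ∀ {x y z} → E x y → E y z → E x z → ⊥
two-colourable⇒triangle-free colour proper xy yz xz = no-three-distinct-parities (proper xy) (proper yz) (proper xz)

∣m-n∣≡1⇒ : ∀ m n → ∣ m - n ∣ ≡ 1 → m ≡ suc n ⊎ n ≡ suc m
∣m-n∣≡1⇒ zero n e = inj₂ e
∣m-n∣≡1⇒ (suc m) zero e = inj₁ e
∣m-n∣≡1⇒ (suc m) (suc n) e = Sum.map (cong suc) (cong suc) (∣m-n∣≡1⇒ m n e)

∣n-1+n∣≡1 : ∀ n → ∣ n - suc n ∣ ≡ 1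
∣n-1+n∣≡1 n = subst (λ x → ∣ n - x ∣ ≡ 1) (ℕ.+-comm n 1) (ℕ.∣m-m+n∣≡n n 1)

suc∣m-n∣≡1⇒m≡n : ∀ m n → suc ∣ m - n ∣ ≡ 1 → m ≡ n
suc∣m-n∣≡1⇒m≡n m n e = ℕ.∣m-n∣≡0⇒m≡n (ℕ.suc-injective e)

unit-step-sums : ∀ a b c d → ∣ a - b ∣ + ∣ c - d ∣ ≡ 1 → a + c ≡ suc (b + d) ⊎ b + d ≡ suc (a + c)
unit-step-sums a b c d e with ∣ a - b ∣ in ab
unit-step-sums a b c d e | zero with refl ← ℕ.∣m-n∣≡0⇒m≡n {a} {b} ab with ∣m-n∣≡1⇒ c d e
... | inj₁ refl = inj₁ (ℕ.+-suc a d)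
... | inj₂ refl = inj₂ (ℕ.+-suc a c)
unit-step-sums a b c d e | suc zero with refl ← suc∣m-n∣≡1⇒m≡n c d e with ∣m-n∣≡1⇒ a b ab
... | inj₁ refl = inj₁ refl
... | inj₂ refl = inj₂ refl
unit-step-sums a b c d () | suc (suc _)

parity-flips : ∀ s → parity (suc s) ≢ parity s
parity-flips s eq = ℙ.p≢p⁻¹ (parity s) (trans (sym eq) (sym (ℙ.⁻¹-selfInverse (ℙ.suc-homo-⁻¹ s))))

unit-step-flips-parity : ∀ a b c d → ∣ a - b ∣ + ∣ c - d ∣ ≡ 1 → parity (a + c) ≢ parity (b + d)
unit-step-flips-parity a b c d e eq with unit-step-sums a b c d e
... | inj₁ s≡1+s' = parity-flips (b + d) (trans (cong parity (sym s≡1+s')) eq)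
... | inj₂ s'≡1+s = parity-flips (a + c) (trans (cong parity (sym s'≡1+s)) (sym eq))

parity-double : ∀ t → parity (t + t) ≡ 0ℙ
parity-double t = trans (ℙ.+-homo-+ t t) (ℙ.p+p≡0ℙ (parity t))

double-injective : ∀ s t → s + s ≡ t + t → s ≡ t
double-injective s t eq = trans (ℕ.n≡⌊n+n/2⌋ s) (trans (cong ⌊_/2⌋ eq) (sym (ℕ.n≡⌊n+n/2⌋ t)))

lex-< : ∀ {a b s t} → a < 3 → s < t → a + 3 * s < b + 3 * t
lex-< {a} {b} {s} {t} a<3 s<t = begin-strict
  a + 3 * s   <⟨ ℕ.+-monoˡ-< (3 * s) a<3 ⟩
  3 + 3 * s   ≡⟨ ℕ.*-suc 3 s ⟨
  3 * suc s   ≤⟨ ℕ.*-monoʳ-≤ 3 s<t ⟩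
  3 * t       ≤⟨ ℕ.m≤n+m (3 * t) b ⟩
  b + 3 * t   ∎
  where open ℕ.≤-Reasoning

lex-injective : ∀ {a b s t} → a < 3 → b < 3 → a + 3 * s ≡ b + 3 * t → a ≡ b × s ≡ t
lex-injective {a} {b} {s} {t} a<3 b<3 eq with ℕ.<-cmp s t
... | tri< s<t _ _ = ⊥-elim (ℕ.<⇒≢ (lex-< {b = b} a<3 s<t) eq)
... | tri> _ _ t<s = ⊥-elim (ℕ.<⇒≢ (lex-< {b = a} b<3 t<s) (sym eq))
... | tri≈ _ refl _ = ℕ.+-cancelʳ-≡ (3 * s) a b eq , refl

no-room : ∀ {a b} → a < b → b < suc a → ⊥
no-room a<b b<1+a = ℕ.<⇒≱ a<b (ℕ.s≤s⁻¹ b<1+a)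

squeezed : ∀ {a b} → a < b → b < suc (suc a) → b ≡ suc a
squeezed a<b b<2+a = ℕ.≤-antisym (ℕ.s≤s⁻¹ b<2+a) a<b

1≤n⇒⌊n/2⌋<n : ∀ {n} → 1 ≤ n → ⌊ n /2⌋ < n
1≤n⇒⌊n/2⌋<n {suc n} _ = ℕ.⌊n/2⌋<n n

Fin-injective⇒surjective : ∀ {m} {f : Fin m → Fin m} → Injective _≡_ _≡_ f → Surjective _≡_ _≡_ f
Fin-injective⇒surjective {suc m} {f} f-inj y with FP.any? (λ x → f x FP.≟ y)
... | yes (x , fx≡y) = x , λ { refl → fx≡y }
... | no ∄x = ⊥-elim (ℕ.1+n≰n (FP.injective⇒≤ punched-injective))
  where
  y≢f : ∀ x → y ≢ f x
  y≢f x eq = ∄x (x , sym eq)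
  punched-injective : Injective _≡_ _≡_ (λ x → F.punchOut (y≢f x))
  punched-injective eq = f-inj (FP.punchOut-injective (y≢f _) (y≢f _) eq)

injective⇒surjective : ∀ {V : Set} {m} (f : V → Fin m) (g : Fin m → V) →
  Injective _≡_ _≡_ g → Injective _≡_ _≡_ f → Surjective _≡_ _≡_ f
injective⇒surjective f g g-inj f-inj y with x , fgx≡y ← Fin-injective⇒surjective (g-inj ∘ f-inj) y =
  g x , λ { refl → fgx≡y refl }

threshold-partition : ∀ {V : Set} {E : V → V → Set} {m} (pos : V → Fin m) →
  Injective _≡_ _≡_ pos → Surjective _≡_ _≡_ pos → ∀ h → h < m →
  (∀ {p q r} → h ≤ toℕ (pos p) → pos p F.< pos q → pos q F.< pos r → E p r → E q r) →
  PrecPartition V m E (suc h)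
-- The first h vertices are singleton classes, the remaining ones form the last class.
threshold-partition {V} {E} {m} pos pos-inj pos-surj h h<m tail-consistent = record
  { pos = pos ; pos-inj = pos-inj ; pos-surj = pos-surj
  ; cls = cls ; cls-surj = cls-surj
  ; consistent = λ p q r p<q q<r p~q → tail-consistent (in-tail p<q p~q) p<q q<r
  ; consecutive = consecutive
  }
  where
  rank : V → ℕ
  rank v = toℕ (pos v)

  cls : V → Fin (suc h)
  cls v = F.fromℕ< (s≤s (ℕ.m⊓n≤n (rank v) h))

  toℕ-cls : ∀ v → toℕ (cls v) ≡ rank v ℕ.⊓ h
  toℕ-cls v = FP.toℕ-fromℕ< _

  cls-surj : Surjective _≡_ _≡_ cls
  cls-surj κ with v , pos-v ← pos-surj (F.fromℕ< (ℕ.≤-<-trans (ℕ.s≤s⁻¹ (FP.toℕ<n κ)) h<m)) =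
    v , λ { refl → FP.toℕ-injective (begin
      toℕ (cls v)          ≡⟨ toℕ-cls v ⟩
      rank v ℕ.⊓ h         ≡⟨ cong (λ i → toℕ i ℕ.⊓ h) (pos-v refl) ⟩
      _ ℕ.⊓ h              ≡⟨ cong (ℕ._⊓ h) (FP.toℕ-fromℕ< _) ⟩
      toℕ κ ℕ.⊓ h          ≡⟨ ℕ.m≤n⇒m⊓n≡m (ℕ.s≤s⁻¹ (FP.toℕ<n κ)) ⟩
      toℕ κ                ∎) }
    where open ≡-Reasoning

  same-cls : ∀ {v w} → cls v ≡ cls w → rank v ℕ.⊓ h ≡ rank w ℕ.⊓ h
  same-cls {v} {w} eq = trans (sym (toℕ-cls v)) (trans (cong toℕ eq) (toℕ-cls w))

  in-tail : ∀ {p q} → pos p F.< pos q → cls p ≡ cls q → h ≤ rank p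
  in-tail {p} {q} p<q p~q with h ℕ.≤? rank p
  ... | yes h≤p = h≤p
  ... | no h≰p = ⊥-elim (ℕ.<-irrefl (trans (sym (ℕ.m≤n⇒m⊓n≡m (ℕ.<⇒≤ p<h))) (same-cls p~q)) (ℕ.⊓-glb p<q p<h))
    where p<h = ℕ.≰⇒> h≰p

  consecutive : ∀ p q r → pos p F.< pos q → pos q F.< pos r → cls p ≡ cls r → cls q ≡ cls p
  consecutive p q r p<q q<r p~r = FP.toℕ-injective (begin
    toℕ (cls q)      ≡⟨ toℕ-cls q ⟩
    rank q ℕ.⊓ h     ≡⟨ ℕ.≤-antisym (ℕ.≤-trans (ℕ.⊓-monoˡ-≤ h (ℕ.<⇒≤ q<r)) (ℕ.≤-reflexive (sym (same-cls p~r))))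
                                    (ℕ.⊓-monoˡ-≤ h (ℕ.<⇒≤ p<q)) ⟩
    rank p ℕ.⊓ h     ≡⟨ toℕ-cls p ⟨
    toℕ (cls p)      ∎)
    where open ≡-Reasoning

data Half : ℕ → Set where
  even : ∀ t → Half (t + t)
  odd  : ∀ t → Half (suc (t + t))

half : ∀ x → Half x
half zero = even zero
half (suc x) with half x
... | even t = odd t
... | odd t = subst Half (cong suc (ℕ.+-suc t t)) (even (suc t))

data Link : Fin 2 → ℕ → Set where
  top-even    : ∀ t → Link 0F (t + t)
  bottom-even : ∀ t → Link 1F (t + t)
  bottom-odd  : ∀ t → Link 1F (suc (t + t))

data Cell : Fin 2 → ℕ → Set where
  lone : ∀ t → Cell 0F (suc (t + t))
  link : ∀ {i x} → Link i x → Cell i x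

cell : ∀ i x → Cell i x
cell 0F x with half x
... | even t = link (top-even t)
... | odd t = lone t
cell 1F x with half x
... | even t = link (bottom-even t)
... | odd t = link (bottom-odd t)

-- GRAdj n (i , c) (j , d) unfolds to Adjacent i (toℕ c) j (toℕ d).
Adjacent : Fin 2 → ℕ → Fin 2 → ℕ → Set
Adjacent i x j y = ∣ toℕ i - toℕ j ∣ + ∣ x - y ∣ ≡ 1

offset block key : ∀ {i x} → Link i x → ℕ
offset (top-even _) = 0
offset (bottom-even _) = 1
offset (bottom-odd _) = 2
block (top-even t) = t
block (bottom-even t) = t
block (bottom-odd t) = t
key ℓ = offset ℓ + 3 * block ℓ

offset<3 : ∀ {i x} (ℓ : Link i x) → offset ℓ < 3
offset<3 (top-even _) = s≤s z≤n
offset<3 (bottom-even _) = s≤s (s≤s z≤n)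
offset<3 (bottom-odd _) = ℕ.≤-refl

coordinates : ℕ → ℕ → Fin 2 × ℕ
coordinates 0 t = 0F , t + t
coordinates 1 t = 1F , t + t
coordinates _ t = 1F , suc (t + t)

coordinates-link : ∀ {i x} (ℓ : Link i x) → coordinates (offset ℓ) (block ℓ) ≡ (i , x)
coordinates-link (top-even _) = refl
coordinates-link (bottom-even _) = refl
coordinates-link (bottom-odd _) = refl

key-injective : ∀ {i x j y} (ℓ : Link i x) (ℓ' : Link j y) → key ℓ ≡ key ℓ' → (i , x) ≡ (j , y)
key-injective ℓ ℓ' eq with o≡o' , b≡b' ← lex-injective (offset<3 ℓ) (offset<3 ℓ') eq =
  trans (sym (coordinates-link ℓ)) (trans (cong₂ coordinates o≡o' b≡b') (coordinates-link ℓ'))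

link-colour : ∀ {i x} → Link i x → Parity
link-colour (top-even _) = 0ℙ
link-colour (bottom-even _) = 1ℙ
link-colour (bottom-odd _) = 0ℙ

parity≡link-colour : ∀ {i x} (ℓ : Link i x) → parity (toℕ i + x) ≡ link-colour ℓ
parity≡link-colour (top-even t) = parity-double t
parity≡link-colour (bottom-even t) =
  trans (sym (ℙ.⁻¹-selfInverse (ℙ.suc-homo-⁻¹ (t + t)))) (cong _⁻¹ (parity-double t))
parity≡link-colour (bottom-odd t) = parity-double t

¬adjacent-same-parity : ∀ {i x j y} (ℓ : Link i x) (ρ : Link j y) →
  link-colour ℓ ≡ link-colour ρ → ¬ Adjacent i x j y
¬adjacent-same-parity {i} {x} {j} {y} ℓ ρ eq adj =
  unit-step-flips-parity (toℕ i) (toℕ j) x y adj (trans (parity≡link-colour ℓ) (trans eq (sym (parity≡link-colour ρ))))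

-- A link's earlier neighbours among links immediately precede it, except that bottom-odd t
-- precedes bottom-even (suc t) by two, with top-even (suc t), another neighbour, in between.
link-consistent : ∀ {i x j y k z} (ℓ : Link i x) (μ : Link j y) (ρ : Link k z) →
  key ℓ < key μ → key μ < key ρ → Adjacent i x k z → Adjacent j y k z
link-consistent ℓ@(top-even _) _ ρ@(top-even _) _ _ adj = ⊥-elim (¬adjacent-same-parity ℓ ρ refl adj)
link-consistent ℓ@(top-even _) _ ρ@(bottom-odd _) _ _ adj = ⊥-elim (¬adjacent-same-parity ℓ ρ refl adj)
link-consistent ℓ@(bottom-even _) _ ρ@(bottom-even _) _ _ adj = ⊥-elim (¬adjacent-same-parity ℓ ρ refl adj)
link-consistent ℓ@(bottom-odd _) _ ρ@(top-even _) _ _ adj = ⊥-elim (¬adjacent-same-parity ℓ ρ refl adj)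
link-consistent ℓ@(bottom-odd _) _ ρ@(bottom-odd _) _ _ adj = ⊥-elim (¬adjacent-same-parity ℓ ρ refl adj)
link-consistent (top-even s) μ (bottom-even t) ℓ<μ μ<ρ adj
  with refl ← double-injective s t (suc∣m-n∣≡1⇒m≡n (s + s) (t + t) adj) = ⊥-elim (no-room ℓ<μ μ<ρ)
link-consistent (bottom-even s) μ (top-even t) ℓ<μ μ<ρ adj
  with refl ← double-injective s t (suc∣m-n∣≡1⇒m≡n (s + s) (t + t) adj) = ⊥-elim (ℕ.<-asym (ℕ.<-trans ℓ<μ μ<ρ) (ℕ.n<1+n _))
link-consistent (bottom-even s) μ (bottom-odd t) ℓ<μ μ<ρ adj with ∣m-n∣≡1⇒ (s + s) (suc (t + t)) adj
... | inj₁ s+s≡2+t+t with refl ← double-injective s (suc t) (trans s+s≡2+t+t (cong suc (sym (ℕ.+-suc t t)))) =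
  ⊥-elim (ℕ.<-asym (ℕ.<-trans ℓ<μ μ<ρ) (lex-< {b = 1} ℕ.≤-refl (ℕ.n<1+n t)))
... | inj₂ 1+t+t≡1+s+s with refl ← double-injective t s (ℕ.suc-injective 1+t+t≡1+s+s) = ⊥-elim (no-room ℓ<μ μ<ρ)
link-consistent (bottom-odd s) μ (bottom-even t) ℓ<μ μ<ρ adj with ∣m-n∣≡1⇒ (suc (s + s)) (t + t) adj
... | inj₁ 1+s+s≡1+t+t with refl ← double-injective s t (ℕ.suc-injective 1+s+s≡1+t+t) =
  ⊥-elim (ℕ.<-asym (ℕ.<-trans ℓ<μ μ<ρ) (ℕ.n<1+n _))
... | inj₂ t+t≡2+s+s with refl ← double-injective t (suc s) (trans t+t≡2+s+s (cong suc (sym (ℕ.+-suc s s))))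
  with refl ← key-injective μ (top-even (suc s))
                 (trans (squeezed ℓ<μ (subst (key μ <_) (cong suc (ℕ.*-suc 3 s)) μ<ρ)) (sym (ℕ.*-suc 3 s))) =
  cong suc (ℕ.∣n-n∣≡0 (suc s + suc s))

module Grid (n : ℕ) where

  h : ℕ
  h = ⌊ n /2⌋

  E : GRV n → GRV n → Set
  E = GRAdj n

  E-sym : ∀ {x y} → E x y → E y x
  E-sym {i , c} {i' , c'} e = trans (cong₂ _+_ (ℕ.∣-∣-comm (toℕ i') (toℕ i)) (ℕ.∣-∣-comm (toℕ c') (toℕ c))) e

  colour : GRV n → Parity
  colour (i , c) = parity (toℕ i + toℕ c)

  colour-proper : ∀ {x y} → E x y → colour x ≢ colour y
  colour-proper {i , c} {i' , c'} = unit-step-flips-parity (toℕ i) (toℕ i') (toℕ c) (toℕ c')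

  triangle-free : ∀ {x y z} → E x y → E y z → E x z → ⊥
  triangle-free {x} {y} {z} = two-colourable⇒triangle-free colour (λ {x} {y} → colour-proper {x} {y}) {x} {y} {z}

  Columns : ℕ → GRV n → Set
  Columns j (_ , l) = toℕ l ≡ j ⊎ toℕ l ≡ suc j

  square : ∀ j → suc j < n → Square E (Columns j)
  square j 1+j<n = record
    { a = 0F , l ; b = 0F , r ; c = 1F , r ; d = 1F , l
    ; ab = subst₂ (λ x y → ∣ x - y ∣ ≡ 1) (sym l≡j) (sym r≡1+j) (∣n-1+n∣≡1 j)
    ; bc = cong suc (ℕ.∣n-n∣≡0 (toℕ r))
    ; cd = subst₂ (λ x y → ∣ x - y ∣ ≡ 1) (sym r≡1+j) (sym l≡j) (trans (ℕ.∣-∣-comm (suc j) j) (∣n-1+n∣≡1 j))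
    ; da = cong suc (ℕ.∣n-n∣≡0 (toℕ l))
    ; a≁c = l≢r ∘ suc∣m-n∣≡1⇒m≡n (toℕ l) (toℕ r)
    ; b≁d = l≢r ∘ sym ∘ suc∣m-n∣≡1⇒m≡n (toℕ r) (toℕ l)
    ; a≢c = λ ()
    ; b≢d = λ ()
    ; ac-common = λ {v} → ac-common {v}
    ; bd-common = λ {v} → bd-common {v}
    ; corners⊆S = inj₁ l≡j ∷ inj₂ r≡1+j ∷ inj₂ r≡1+j ∷ inj₁ l≡j ∷ []
    }
    where
    l r : Fin n
    l = F.fromℕ< (ℕ.<-trans (ℕ.n<1+n j) 1+j<n)
    r = F.fromℕ< 1+j<n
    l≡j : toℕ l ≡ j
    l≡j = FP.toℕ-fromℕ< _
    r≡1+j : toℕ r ≡ suc j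
    r≡1+j = FP.toℕ-fromℕ< _
    l≢r : toℕ l ≢ toℕ r
    l≢r eq = ℕ.1+n≢n (trans (sym r≡1+j) (trans (sym eq) l≡j))
    ac-common : ∀ {v} → E v (0F , l) → E v (1F , r) → Columns j v
    ac-common {0F , x} _ vc = inj₂ (trans (suc∣m-n∣≡1⇒m≡n (toℕ x) (toℕ r) vc) r≡1+j)
    ac-common {1F , x} va _ = inj₁ (trans (suc∣m-n∣≡1⇒m≡n (toℕ x) (toℕ l) va) l≡j)
    bd-common : ∀ {v} → E v (0F , r) → E v (1F , l) → Columns j v
    bd-common {0F , x} _ vd = inj₁ (trans (suc∣m-n∣≡1⇒m≡n (toℕ x) (toℕ l) vd) l≡j)
    bd-common {1F , x} vb _ = inj₂ (trans (suc∣m-n∣≡1⇒m≡n (toℕ x) (toℕ r) vb) r≡1+j)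

  square-fits : ∀ {i} → i < h → suc (i + i) < n
  square-fits {i} i<h = begin
    suc (suc (i + i))   ≡⟨ cong suc (ℕ.+-suc i i) ⟨
    suc i + suc i       ≤⟨ ℕ.+-mono-≤ i<h (ℕ.≤-trans i<h (ℕ.⌊n/2⌋≤⌈n/2⌉ n)) ⟩
    ⌊ n /2⌋ + ⌈ n /2⌉   ≡⟨ ℕ.⌊n/2⌋+⌈n/2⌉≡n n ⟩
    n                   ∎
    where open ℕ.≤-Reasoning

  Columns-half : ∀ {i v} → Columns (i + i) v → ⌊ toℕ (proj₂ v) /2⌋ ≡ i
  Columns-half {i} (inj₁ l≡2i) = trans (cong ⌊_/2⌋ l≡2i) (sym (ℕ.n≡⌊n+n/2⌋ i))
  Columns-half {i} (inj₂ l≡1+2i) = trans (cong ⌊_/2⌋ l≡1+2i) (sym (ℕ.n≡⌈n+n/2⌉ i))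

  lower-bound : 1 ≤ n → ∀ k → PrecPartition (GRV n) (2 * n) E k → suc h ≤ k
  lower-bound 1≤n k P = more-classes-than-disjoint-squares Q disjoint (0F , F.fromℕ< 1≤n)
    where
    -- E x y computes, so its vertices cannot be inferred and are passed explicitly.
    open PrecPartitionProperties {E = E} (λ {x} {y} → E-sym {x} {y}) (λ {x} {y} {z} → triangle-free {x} {y} {z}) P
    Q : (i : Fin h) → Square E (Columns (toℕ i + toℕ i))
    Q i = square (toℕ i + toℕ i) (square-fits (FP.toℕ<n i))
    disjoint : ∀ {i j} → i ≢ j → ∀ {v} → Columns (toℕ i + toℕ i) v → ¬ Columns (toℕ j + toℕ j) v
    disjoint {i} {j} i≢j {v} Si Sj =
      i≢j (FP.toℕ-injective (trans (sym (Columns-half {toℕ i} {v} Si)) (Columns-half {toℕ j} {v} Sj)))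

  rank : ∀ {i x} → Cell i x → ℕ
  rank (lone t) = t
  rank (link ℓ) = h + key ℓ

  lone<h : ∀ {t} → suc (t + t) < n → t < h
  lone<h {t} 2+2t≤n = subst (_≤ h) (cong suc (sym (ℕ.n≡⌊n+n/2⌋ t))) (ℕ.⌊n/2⌋-mono 2+2t≤n)

  h+t<n : ∀ {t} → t + t < n → h + t < n
  h+t<n {t} 1+2t≤n = begin-strict
    h + t             <⟨ ℕ.+-monoʳ-< h (subst (_≤ ⌈ n /2⌉) (cong suc (sym (ℕ.n≡⌊n+n/2⌋ t))) (ℕ.⌈n/2⌉-mono 1+2t≤n)) ⟩
    h + ⌈ n /2⌉       ≡⟨ ℕ.⌊n/2⌋+⌈n/2⌉≡n n ⟩
    n                 ∎
    where open ℕ.≤-Reasoning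

  h+block<n : ∀ {i x} (ℓ : Link i x) → x < n → h + block ℓ < n
  h+block<n (top-even t) x<n = h+t<n x<n
  h+block<n (bottom-even t) x<n = h+t<n x<n
  h+block<n (bottom-odd t) x<n = h+t<n (ℕ.<-trans (ℕ.n<1+n _) x<n)

  key≡block+row+column : ∀ {i x} (ℓ : Link i x) → key ℓ ≡ block ℓ + (toℕ i + x)
  key≡block+row+column (top-even t) = top t
    where
    top : ∀ t → 0 + 3 * t ≡ t + (t + t)
    top = solve-∀
  key≡block+row+column (bottom-even t) = bottom t
    where
    bottom : ∀ t → 1 + 3 * t ≡ t + (1 + (t + t))
    bottom = solve-∀
  key≡block+row+column (bottom-odd t) = bottom t
    where
    bottom : ∀ t → 2 + 3 * t ≡ t + (1 + suc (t + t))
    bottom = solve-∀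

  row+column≤n : ∀ (i : Fin 2) {x} → x < n → toℕ i + x ≤ n
  row+column≤n 0F x<n = ℕ.<⇒≤ x<n
  row+column≤n 1F x<n = x<n

  rank<2n : ∀ {i x} (w : Cell i x) → x < n → rank w < 2 * n
  rank<2n (lone t) x<n = ℕ.<-≤-trans (lone<h x<n) (ℕ.≤-trans (ℕ.⌊n/2⌋≤n n) (ℕ.m≤m+n n (n + 0)))
  rank<2n {i} {x} (link ℓ) x<n = begin-strict
    h + key ℓ                       ≡⟨ cong (h +_) (key≡block+row+column ℓ) ⟩
    h + (block ℓ + (toℕ i + x))     ≡⟨ ℕ.+-assoc h (block ℓ) (toℕ i + x) ⟨
    (h + block ℓ) + (toℕ i + x)     <⟨ ℕ.+-mono-<-≤ (h+block<n ℓ x<n) (row+column≤n i x<n) ⟩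
    n + n                           ≡⟨ cong (n +_) (ℕ.+-identityʳ n) ⟨
    2 * n                           ∎
    where open ℕ.≤-Reasoning

  cell-injective : ∀ {i x j y} (w : Cell i x) (w' : Cell j y) → x < n → y < n → rank w ≡ rank w' → (i , x) ≡ (j , y)
  cell-injective (lone t) (lone t) _ _ refl = refl
  cell-injective (lone t) (link ℓ) x<n _ eq = ⊥-elim (ℕ.<⇒≱ (lone<h x<n) (subst (h ≤_) (sym eq) (ℕ.m≤m+n h _)))
  cell-injective (link ℓ) (lone t) _ y<n eq = ⊥-elim (ℕ.<⇒≱ (lone<h y<n) (subst (h ≤_) eq (ℕ.m≤m+n h _)))
  cell-injective (link ℓ) (link ℓ') _ _ eq = key-injective ℓ ℓ' (ℕ.+-cancelˡ-≡ h _ _ eq)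

  cell-consistent : ∀ {i x j y k z} (p : Cell i x) (q : Cell j y) (r : Cell k z) → x < n → y < n → z < n →
    h ≤ rank p → rank p < rank q → rank q < rank r → Adjacent i x k z → Adjacent j y k z
  cell-consistent (lone t) _ _ x<n _ _ h≤p _ _ _ = ⊥-elim (ℕ.<⇒≱ (lone<h x<n) h≤p)
  cell-consistent (link _) (lone t) _ _ y<n _ h≤p p<q _ _ =
    ⊥-elim (ℕ.<⇒≱ (lone<h y<n) (ℕ.≤-trans h≤p (ℕ.<⇒≤ p<q)))
  cell-consistent (link _) (link _) (lone t) _ _ z<n h≤p p<q q<r _ =
    ⊥-elim (ℕ.<⇒≱ (lone<h z<n) (ℕ.≤-trans h≤p (ℕ.<⇒≤ (ℕ.<-trans p<q q<r))))
  cell-consistent (link ℓ) (link μ) (link ρ) _ _ _ _ p<q q<r =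
    link-consistent ℓ μ ρ (ℕ.+-cancelˡ-< h _ _ p<q) (ℕ.+-cancelˡ-< h _ _ q<r)

  vertex-rank : GRV n → ℕ
  vertex-rank (i , c) = rank (cell i (toℕ c))

  position : GRV n → Fin (2 * n)
  position (i , c) = F.fromℕ< (rank<2n (cell i (toℕ c)) (FP.toℕ<n c))

  toℕ-position : ∀ v → toℕ (position v) ≡ vertex-rank v
  toℕ-position (i , c) = FP.toℕ-fromℕ< _

  position-injective : Injective _≡_ _≡_ position
  position-injective {i , c} {j , d} eq = cong₂ _,_ (cong proj₁ same) (FP.toℕ-injective (cong proj₂ same))
    where
    same : (i , toℕ c) ≡ (j , toℕ d)
    same = cell-injective (cell i (toℕ c)) (cell j (toℕ d)) (FP.toℕ<n c) (FP.toℕ<n d)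
             (trans (sym (toℕ-position (i , c))) (trans (cong toℕ eq) (toℕ-position (j , d))))

  position-surjective : Surjective _≡_ _≡_ position
  position-surjective = injective⇒surjective position (F.remQuot n) remQuot-injective position-injective
    where
    remQuot-injective : Injective _≡_ _≡_ (F.remQuot {2} n)
    remQuot-injective {x} {y} eq = begin
      x                               ≡⟨ FP.combine-remQuot {2} n x ⟨
      uncurry F.combine (F.remQuot n x) ≡⟨ cong (uncurry F.combine) eq ⟩
      uncurry F.combine (F.remQuot n y) ≡⟨ FP.combine-remQuot {2} n y ⟩
      y                               ∎
      where open ≡-Reasoning

  tail-consistent : ∀ {p q r} → h ≤ toℕ (position p) → position p F.< position q → position q F.< position r →
                    GRAdj n p r → GRAdj n q r
  tail-consistent {i , c} {j , d} {k , e} h≤p p<q q<r =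
    cell-consistent (cell i (toℕ c)) (cell j (toℕ d)) (cell k (toℕ e)) (FP.toℕ<n c) (FP.toℕ<n d) (FP.toℕ<n e)
      (subst (h ≤_) (toℕ-position (i , c)) h≤p)
      (subst₂ _<_ (toℕ-position (i , c)) (toℕ-position (j , d)) p<q)
      (subst₂ _<_ (toℕ-position (j , d)) (toℕ-position (k , e)) q<r)

  upper-bound : 1 ≤ n → PrecPartition (GRV n) (2 * n) (GRAdj n) (suc h)
  upper-bound 1≤n = threshold-partition position position-injective position-surjective h
    (ℕ.<-≤-trans (1≤n⇒⌊n/2⌋<n 1≤n) (ℕ.m≤m+n n (n + 0)))
    (λ {p} {q} {r} → tail-consistent {p} {q} {r})

theorem32 : (n : ℕ) → 1 ≤ n → IsThinPrec (GRV n) (2 * n) (GRAdj n) ⌈ suc n /2⌉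
theorem32 n 1≤n = Grid.upper-bound n 1≤n , Grid.lower-bound n 1≤n
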